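{- Let $\lambda$ be a Young diagram (a finite set of cells $(i,j)$, $i$ the row and $j$ the column, $i,j\geq1$, such that $(i,j)\in\lambda$, $1\leq i'\leq i$, $1\leq j'\leq j$ imply $(i',j')\in\lambda$), and let $d$ be the length of its diagonal: $(d,d)\in\lambda$, $(d+1,d+1)\notin\lambda$. Work over $\mathbb{Z}[x]=\mathbb{Z}[x_s:s\in\lambda]$ with independent indeterminates $x_s$. For $1\leq i,j\leq d+1$ let $\lambda(i,j)=\{(u,v)\in\lambda: i\leq u,\ j\leq v\}$, $A_{ij}=F(\lambda(i,j))$ and $A(\lambda)=(A_{ij})_{1\leq i,j\leq d+1}$. Then $A(\lambda)=UDL$, where (i) $U=(U_{ik})_{1\leq i,k\leq d+1}$ with $U_{ik}=F(U(i,k))$ for $i\leq k$, where $U(i,k)=\{(u,v)\in\lambda: i\leq u<k\leq v\}$, and $U_{ik}=0$ for $i>k$; (ii) $D=\mathrm{diag}(D_{11},\ldots,D_{d+1,d+1})$ with $D_{kk}=\prod_{s\in\lambda(k,k)}x_s$; (iii) $L=(L_{kj})_{1\leq k,j\leq d+1}$ with $L_{kj}=F(L(k,j))$ for $j\leq k$, where $L(k,j)=\{(u,v)\in\lambda: j\leq v<k\leq u\}$, and $L_{kj}=0$ for $j>k$; and in particular $U$ is upper unitriangular and $L$ is lower unitriangular.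
   Context: For a finite set $S$ of cells, call $\mu\subseteq S$ an initial subshape of $S$ if whenever $(u,v)\in\mu$, $(u',v')\in S$, $u'\leq u$ and $v'\leq v$, then $(u',v')\in\mu$ (the empty set is allowed). The generating function for skew shapes of $S$ is $F(S)=\sum_{\mu}\prod_{s\in S\setminus\mu}x_s$, the sum over all initial subshapes $\mu$ of $S$; in particular $F(\emptyset)=1$. Empty products equal $1$. -}

module Defs where

open import Level using (Level)
open import Data.Bool using (Bool; true; false; _∧_; _∨_; not)
open import Data.Nat using (ℕ; zero; suc; _≤ᵇ_; _≡ᵇ_; _<ᵇ_; _≤_)
open import Data.Product using (_×_; _,_; proj₁; proj₂)
open import Data.List using (List; []; _∷_; map; concatMap; filterᵇ; foldr)
open import Data.Bool.ListAction using (all; any)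
open import Data.Fin using (Fin; toℕ)
open import Algebra.Bundles using (CommutativeRing)

-- Cells (u , v): u the row, v the column (1-indexed).
Cell : Set
Cell = ℕ × ℕ

-- A finite set of cells is represented by a duplicate-free list of cells.
CellSet : Set
CellSet = List Cell

cell≡ᵇ : Cell → Cell → Bool
cell≡ᵇ (a , b) (c , d) = (a ≡ᵇ c) ∧ (b ≡ᵇ d)

memᵇ : Cell → CellSet → Bool
memᵇ s S = any (cell≡ᵇ s) S

-- All ways of splitting a list into (chosen subset , complement).
-- For a duplicate-free list this enumerates every subset exactly once.
splits : {A : Set} → List A → List (List A × List A)
splits [] = ([] , []) ∷ []
splits (a ∷ as) =
  concatMap (λ pq → (a ∷ proj₁ pq , proj₂ pq) ∷ (proj₁ pq , a ∷ proj₂ pq) ∷ [])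
            (splits as)

isInitialᵇ : CellSet → CellSet → Bool
isInitialᵇ μ S =
  all (λ c → all (λ c' → not ((proj₁ c' ≤ᵇ proj₁ c) ∧ (proj₂ c' ≤ᵇ proj₂ c))
                           ∨ memᵇ c' μ) S) μ

module _ {c ℓ : Level} (R : CommutativeRing c ℓ) where
  open CommutativeRing R

  prodR : List Carrier → Carrier
  prodR = foldr _*_ 1#

  sumR : List Carrier → Carrier
  sumR = foldr _+_ 0#

  monomial : (Cell → Carrier) → CellSet → Carrier
  monomial x S = prodR (map x S)

  -- F(S) = Σ_{μ initial subshape of S} ∏_{s ∈ S ∖ μ} x_s
  F : (Cell → Carrier) → CellSet → Carrier
  F x S = sumR (map (λ pq → monomial x (proj₂ pq))
                    (filterᵇ (λ pq → isInitialᵇ (proj₁ pq) S) (splits S)))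

  sumFin : (n : ℕ) → (Fin n → Carrier) → Carrier
  sumFin zero f = 0#
  sumFin (suc n) f = f Fin.zero + sumFin n (λ k → f (Fin.suc k))

-- index k : Fin (d+1) corresponds to k+1 ∈ {1,…,d+1}
ix : {n : ℕ} → Fin n → ℕ
ix k = suc (toℕ k)

subλ : CellSet → ℕ → ℕ → CellSet
subλ λ' i j = filterᵇ (λ c → (i ≤ᵇ proj₁ c) ∧ (j ≤ᵇ proj₂ c)) λ'

Uset : CellSet → ℕ → ℕ → CellSet
Uset λ' i k = filterᵇ (λ c → (i ≤ᵇ proj₁ c) ∧ (proj₁ c <ᵇ k) ∧ (k ≤ᵇ proj₂ c)) λ'

Lset : CellSet → ℕ → ℕ → CellSet
Lset λ' k j = filterᵇ (λ c → (j ≤ᵇ proj₂ c) ∧ (proj₂ c <ᵇ k) ∧ (k ≤ᵇ proj₁ c)) λ'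

module Matrices {c ℓ : Level} (R : CommutativeRing c ℓ)
                (λ' : CellSet) (x : Cell → CommutativeRing.Carrier R) (d : ℕ) where
  open CommutativeRing R

  Amat : Fin (suc d) → Fin (suc d) → Carrier
  Amat i j = F R x (subλ λ' (ix i) (ix j))

  Umat : Fin (suc d) → Fin (suc d) → Carrier
  Umat i k with ix i ≤ᵇ ix k
  ... | true  = F R x (Uset λ' (ix i) (ix k))
  ... | false = 0#

  Dmat : Fin (suc d) → Carrier
  Dmat k = monomial R x (subλ λ' (ix k) (ix k))

  Lmat : Fin (suc d) → Fin (suc d) → Carrier
  Lmat k j with ix j ≤ᵇ ix k
  ... | true  = F R x (Lset λ' (ix k) (ix j))
  ... | false = 0#

  UDL : Fin (suc d) → Fin (suc d) → Carrier
  UDL i j = sumFin R (suc d) (λ k → Umat i k * Dmat k * Lmat k j)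

-- If S is the disjoint union of two mutually incomparable pieces, F(S) is the
-- product of F over the pieces. For a cell c ∈ S, sorting the μ by whether they contain c gives
--   F(S) = x^{S_{≥c}} · F(S ∖ S_{≥c}) + F(S ∖ S_{≤c}),
-- because μ ∌ c misses everything above c, while μ ∋ c contains everything below c.
--
-- Now peel λ(i,j) square by square. Let S_m be the cells of λ(i,j) outside [1,m]² and k = m + 1.
-- If i, j ≤ k ≤ d, the corner rule at (k,k) gives F(S_m) = D_kk · F(H_m) + F(S_k), where the
-- hook H_m of cells of S_m not weakly above (k,k) is the disjoint union of the incomparable
-- arms U(i,k) and L(k,j), so F(H_m) = U_ik L_kj. If k < i or k < j, then S_m = S_k and the
-- term U_ik D_kk L_kj vanishes.
-- As (d+1,d+1) ∉ λ, S_d is itself a hook and D_{d+1,d+1} = 1, so telescoping from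
-- S_0 = λ(i,j) gives A_ij = Σ_k U_ik D_kk L_kj.

module Submission where

open import Defs
open import Level using (Level)
open import Function using (_∘_; _⇔_; mk⇔; Equivalence)
import Function.Properties.Equivalence as ⇔
open import Data.Product.Function.NonDependent.Propositional using (_×-⇔_)
open import Data.Bool using (Bool; true; false; _∧_; _∨_; not; T; if_then_else_)
open import Data.Bool.Properties using (T-∧; T-∨; T-≡; T-not-≡; if-cong)
open import Data.Unit using (tt)
open import Data.Fin using (Fin; toℕ)
open import Data.Fin.Properties using (toℕ<n)
open import Data.Empty using (⊥-elim)
open import Data.Nat using (ℕ; zero; suc; _≤_; _<_; _≤ᵇ_; _<ᵇ_; _≤?_; z≤n; s≤s) renaming (_+_ to _+ℕ_)
open import Data.Nat.Properties as ℕ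
  using (≤ᵇ⇒≤; ≤⇒≤ᵇ; <ᵇ⇒<; <⇒<ᵇ; ≡ᵇ⇒≡; ≡⇒≡ᵇ; ≤-trans; ≤-refl; <⇒≤; <⇒≱; ≰⇒>; <-≤-trans)
open import Data.Product using (_×_; _,_; proj₁; proj₂)
open import Data.Sum using (_⊎_; inj₁; inj₂; [_,_]′)
open import Data.List using (List; []; _∷_; _++_; map; filterᵇ; concatMap)
open import Data.List.Membership.Propositional using (_∈_; _∉_)
open import Data.List.Membership.Propositional.Properties using (∈-filter⁺; ∈-filter⁻; ∈-++⁺ˡ; ∈-++⁺ʳ; ∈-++⁻)
open import Data.List.Properties using (filter-none)
open import Data.List.Relation.Unary.Any using (here; there)
open import Data.List.Relation.Unary.All as All using (All)
open import Data.List.Relation.Unary.All.Properties using (all⁺; all⁻)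
import Data.List.Relation.Unary.Any as Any
open import Data.List.Relation.Unary.Any.Properties using (any⁺; any⁻)
open import Data.List.Relation.Unary.AllPairs using (_∷_)
open import Data.List.Relation.Unary.Unique.Propositional using (Unique)
open import Data.List.Relation.Unary.Unique.Propositional.Properties using (filter⁺)
open import Data.List.Relation.Binary.Sublist.Propositional using (_⊆_; []; _∷_; _∷ʳ_; lookup)
open import Data.List.Relation.Binary.Permutation.Propositional using (_↭_; prep; ↭-sym)
open import Data.List.Relation.Binary.Permutation.Propositional.Properties using (shift; ∈-resp-↭)
open import Relation.Binary.PropositionalEquality as ≡ using (_≡_; refl; cong; cong₂)
open import Relation.Nullary using (¬_; yes; no)
open import Relation.Nullary.Decidable using (T?)
open import Algebra.Bundles using (CommutativeRing)

module _ {A : Set} where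

  ∈-filterᵇ⁺ : ∀ (p : A → Bool) {a xs} → a ∈ xs → T (p a) → a ∈ filterᵇ p xs
  ∈-filterᵇ⁺ p = ∈-filter⁺ (T? ∘ p)

  ∈-filterᵇ⁻ : ∀ (p : A → Bool) xs {a} → a ∈ filterᵇ p xs → a ∈ xs × T (p a)
  ∈-filterᵇ⁻ p xs = ∈-filter⁻ (T? ∘ p) {xs = xs}

  filterᵇ-filterᵇ : ∀ (p q : A → Bool) xs →
                    filterᵇ q (filterᵇ p xs) ≡ filterᵇ (λ a → p a ∧ q a) xs
  filterᵇ-filterᵇ p q [] = refl
  filterᵇ-filterᵇ p q (a ∷ xs) with p a
  ... | false = filterᵇ-filterᵇ p q xs
  ... | true with q a
  ...   | true  = cong (a ∷_) (filterᵇ-filterᵇ p q xs)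
  ...   | false = filterᵇ-filterᵇ p q xs

  filterᵇ-cong : ∀ {p q : A → Bool} xs → (∀ {a} → a ∈ xs → T (p a) ⇔ T (q a)) →
                 filterᵇ p xs ≡ filterᵇ q xs
  filterᵇ-cong [] p⇔q = refl
  filterᵇ-cong {p} {q} (a ∷ xs) p⇔q
    with p a | q a | p⇔q (here refl) | filterᵇ-cong xs (p⇔q ∘ there)
  ... | true  | true  | _  | eq = cong (a ∷_) eq
  ... | false | false | _  | eq = eq
  ... | true  | false | pq | _  = ⊥-elim (Equivalence.to pq tt)
  ... | false | true  | pq | _  = ⊥-elim (Equivalence.from pq tt)

  filterᵇ-filterᵇ-≐ : ∀ (p q r : A → Bool) xs → (∀ {a} → a ∈ xs → T (p a ∧ q a) ⇔ T (r a)) →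
                      filterᵇ q (filterᵇ p xs) ≡ filterᵇ r xs
  filterᵇ-filterᵇ-≐ p q r xs pq⇔r = ≡.trans (filterᵇ-filterᵇ p q xs) (filterᵇ-cong xs pq⇔r)

T-not : ∀ {b} → T (not b) ⇔ (¬ T b)
T-not {false} = mk⇔ (λ _ ()) (λ _ → tt)
T-not {true}  = mk⇔ (λ ()) (λ ¬t → ¬t tt)

if-T : ∀ {a} {A : Set a} {b} {t e : A} → T b → (if b then t else e) ≡ t
if-T = if-cong ∘ Equivalence.to T-≡

if-¬T : ∀ {a} {A : Set a} {b} {t e : A} → ¬ T b → (if b then t else e) ≡ e
if-¬T = if-cong ∘ Equivalence.to T-not-≡ ∘ Equivalence.from T-not

T-≤ᵇ : ∀ m n → T (m ≤ᵇ n) ⇔ m ≤ n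
T-≤ᵇ m n = mk⇔ (≤ᵇ⇒≤ m n) ≤⇒≤ᵇ

T-<ᵇ : ∀ m n → T (m <ᵇ n) ⇔ m < n
T-<ᵇ m n = mk⇔ (<ᵇ⇒< m n) <⇒<ᵇ

_≤ᶜ_ : Cell → Cell → Set
c ≤ᶜ c' = proj₁ c ≤ proj₁ c' × proj₂ c ≤ proj₂ c'

_≤ᶜᵇ_ : Cell → Cell → Bool
c ≤ᶜᵇ c' = (proj₁ c ≤ᵇ proj₁ c') ∧ (proj₂ c ≤ᵇ proj₂ c')

≤ᶜ-trans : ∀ {a b c} → a ≤ᶜ b → b ≤ᶜ c → a ≤ᶜ c
≤ᶜ-trans (p , q) (r , s) = ≤-trans p r , ≤-trans q s

≤ᶜ-refl : ∀ {c} → c ≤ᶜ c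
≤ᶜ-refl = ≤-refl , ≤-refl

T-≤ᶜᵇ : ∀ c c' → T (c ≤ᶜᵇ c') ⇔ c ≤ᶜ c'
T-≤ᶜᵇ c c' = mk⇔
  (λ h → let a , b = Equivalence.to T-∧ h in ≤ᵇ⇒≤ _ _ a , ≤ᵇ⇒≤ _ _ b)
  (λ (a , b) → Equivalence.from T-∧ (≤⇒≤ᵇ a , ≤⇒≤ᵇ b))

T-cell≡ᵇ : ∀ {c c'} → T (cell≡ᵇ c c') ⇔ c ≡ c'
T-cell≡ᵇ {a , b} {a' , b'} = mk⇔
  (λ h → let p , q = Equivalence.to T-∧ h in cong₂ _,_ (≡ᵇ⇒≡ a a' p) (≡ᵇ⇒≡ b b' q))
  (λ { refl → Equivalence.from T-∧ (≡⇒≡ᵇ a a refl , ≡⇒≡ᵇ b b refl) })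

T-memᵇ : ∀ c S → T (memᵇ c S) ⇔ c ∈ S
T-memᵇ c S = mk⇔
  (λ h → Any.map (Equivalence.to T-cell≡ᵇ) (any⁻ (cell≡ᵇ c) S h))
  (λ m → any⁺ (cell≡ᵇ c) (Any.map (Equivalence.from T-cell≡ᵇ) m))

IsInitial : CellSet → CellSet → Set
IsInitial μ S = ∀ {c c'} → c ∈ μ → c' ∈ S → c' ≤ᶜ c → c' ∈ μ

T-isInitialᵇ : ∀ μ S → T (isInitialᵇ μ S) ⇔ IsInitial μ S
T-isInitialᵇ μ S = mk⇔ initial
  (λ h → all⁻ _ (All.tabulate λ c∈μ → all⁻ _ (All.tabulate λ c'∈S → closed h c∈μ c'∈S)))
  where
  initial : T (isInitialᵇ μ S) → IsInitial μ S
  initial h {c} {c'} c∈μ c'∈S c'≤c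
    with Equivalence.to T-∨ (All.lookup (all⁺ _ S (All.lookup (all⁺ _ μ h) c∈μ)) c'∈S)
  ... | inj₁ c'≰c = ⊥-elim (Equivalence.to T-not c'≰c (Equivalence.from (T-≤ᶜᵇ c' c) c'≤c))
  ... | inj₂ c'∈μ = Equivalence.to (T-memᵇ c' μ) c'∈μ

  closed : IsInitial μ S → ∀ {c c'} → c ∈ μ → c' ∈ S → T (not (c' ≤ᶜᵇ c) ∨ memᵇ c' μ)
  closed h {c} {c'} c∈μ c'∈S with T? (c' ≤ᶜᵇ c)
  ... | yes c'≤c = Equivalence.from T-∨ (inj₂ (Equivalence.from (T-memᵇ c' μ)
                     (h c∈μ c'∈S (Equivalence.to (T-≤ᶜᵇ c' c) c'≤c))))
  ... | no  c'≰c = Equivalence.from T-∨ (inj₁ (Equivalence.from T-not c'≰c))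

IsInitial-resp-↭ : ∀ {μ ν S} → μ ↭ ν → IsInitial μ S → IsInitial ν S
IsInitial-resp-↭ μ↭ν h c∈ν c'∈S c'≤c = ∈-resp-↭ μ↭ν (h (∈-resp-↭ (↭-sym μ↭ν) c∈ν) c'∈S c'≤c)

IsInitial-restrict : ∀ {μ T S} → (∀ {a} → a ∈ T → a ∈ S) → IsInitial μ S → IsInitial μ T
IsInitial-restrict T⊆S h c∈μ c'∈T = h c∈μ (T⊆S c'∈T)

IsInitial-trans : ∀ {μ T S} → μ ⊆ T → IsInitial T S → IsInitial μ T → IsInitial μ S
IsInitial-trans μ⊆T hT hμ c∈μ c'∈S c'≤c = hμ c∈μ (hT (lookup μ⊆T c∈μ) c'∈S c'≤c) c'≤c

notAbove-isInitial : ∀ c S → IsInitial (filterᵇ (not ∘ (c ≤ᶜᵇ_)) S) S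
notAbove-isInitial c S {e} {c'} e∈B c'∈S c'≤e = ∈-filterᵇ⁺ (not ∘ (c ≤ᶜᵇ_)) c'∈S
  (Equivalence.from T-not λ c≤c' → Equivalence.to T-not (proj₂ (∈-filterᵇ⁻ _ S e∈B))
    (Equivalence.from (T-≤ᶜᵇ c e) (≤ᶜ-trans (Equivalence.to (T-≤ᶜᵇ c c') c≤c') c'≤e)))

below-isInitial : ∀ c S → IsInitial (filterᵇ (_≤ᶜᵇ c) S) S
below-isInitial c S {e} {c'} e∈A c'∈S c'≤e = ∈-filterᵇ⁺ (_≤ᶜᵇ c) c'∈S
  (Equivalence.from (T-≤ᶜᵇ c' c) (≤ᶜ-trans c'≤e (Equivalence.to (T-≤ᶜᵇ e c) (proj₂ (∈-filterᵇ⁻ _ S e∈A)))))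

module Partition (p : Cell → Bool) (S : CellSet) where

  A B : CellSet
  A = filterᵇ p S
  B = filterᵇ (not ∘ p) S

  A⊆S : ∀ {a} → a ∈ A → a ∈ S
  A⊆S = proj₁ ∘ ∈-filterᵇ⁻ p S

  B⊆S : ∀ {a} → a ∈ B → a ∈ S
  B⊆S = proj₁ ∘ ∈-filterᵇ⁻ (not ∘ p) S

  A∩B≡∅ : ∀ {a} → a ∈ A → a ∉ B
  A∩B≡∅ a∈A a∈B =
    Equivalence.to T-not (proj₂ (∈-filterᵇ⁻ (not ∘ p) S a∈B)) (proj₂ (∈-filterᵇ⁻ p S a∈A))

  A∪B≡S : ∀ {a} → a ∈ S → a ∈ A ⊎ a ∈ B
  A∪B≡S {a} a∈S with T? (p a)
  ... | yes pa = inj₁ (∈-filterᵇ⁺ p a∈S pa)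
  ... | no ¬pa = inj₂ (∈-filterᵇ⁺ (not ∘ p) a∈S (Equivalence.from T-not ¬pa))

  IsInitial-A++ : ∀ {ν} → IsInitial A S → ν ⊆ B → IsInitial (A ++ ν) S ⇔ IsInitial ν B
  IsInitial-A++ {ν} hA ν⊆B = mk⇔ to from
    where
    to : IsInitial (A ++ ν) S → IsInitial ν B
    to h c∈ν c'∈B c'≤c with ∈-++⁻ A (h (∈-++⁺ʳ A c∈ν) (B⊆S c'∈B) c'≤c)
    ... | inj₁ c'∈A = ⊥-elim (A∩B≡∅ c'∈A c'∈B)
    ... | inj₂ c'∈ν = c'∈ν

    from : IsInitial ν B → IsInitial (A ++ ν) S
    from h c∈Aν c'∈S c'≤c with ∈-++⁻ A c∈Aν | A∪B≡S c'∈S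
    ... | inj₁ c∈A | _         = ∈-++⁺ˡ (hA c∈A c'∈S c'≤c)
    ... | inj₂ _   | inj₁ c'∈A = ∈-++⁺ˡ c'∈A
    ... | inj₂ c∈ν | inj₂ c'∈B = ∈-++⁺ʳ A (h c∈ν c'∈B c'≤c)

  IsInitial-++ : ∀ {μ ν} → IsInitial A S → IsInitial B S → μ ⊆ A → ν ⊆ B →
                 IsInitial (μ ++ ν) S ⇔ (IsInitial μ A × IsInitial ν B)
  IsInitial-++ {μ} {ν} hA hB μ⊆A ν⊆B = mk⇔ to from
    where
    to : IsInitial (μ ++ ν) S → IsInitial μ A × IsInitial ν B
    to h = toA , toB
      where
      toA : IsInitial μ A
      toA c∈μ c'∈A c'≤c with ∈-++⁻ μ (h (∈-++⁺ˡ c∈μ) (A⊆S c'∈A) c'≤c)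
      ... | inj₁ c'∈μ = c'∈μ
      ... | inj₂ c'∈ν = ⊥-elim (A∩B≡∅ c'∈A (lookup ν⊆B c'∈ν))

      toB : IsInitial ν B
      toB c∈ν c'∈B c'≤c with ∈-++⁻ μ (h (∈-++⁺ʳ μ c∈ν) (B⊆S c'∈B) c'≤c)
      ... | inj₁ c'∈μ = ⊥-elim (A∩B≡∅ (lookup μ⊆A c'∈μ) c'∈B)
      ... | inj₂ c'∈ν = c'∈ν

    from : IsInitial μ A × IsInitial ν B → IsInitial (μ ++ ν) S
    from (hμ , hν) c∈μν c'∈S c'≤c with ∈-++⁻ μ c∈μν
    ... | inj₁ c∈μ = ∈-++⁺ˡ (IsInitial-trans μ⊆A hA hμ c∈μ c'∈S c'≤c)
    ... | inj₂ c∈ν = ∈-++⁺ʳ μ (IsInitial-trans ν⊆B hB hν c∈ν c'∈S c'≤c)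

module Expansion {r ℓ : Level} (R : CommutativeRing r ℓ) (x : Cell → CommutativeRing.Carrier R) where
  open CommutativeRing R renaming (refl to ≈-refl; sym to ≈-sym; trans to ≈-trans)
  open import Relation.Binary.Reasoning.Setoid setoid
  open import Algebra.Properties.CommutativeSemigroup +-commutativeSemigroup
    using () renaming (interchange to +-interchange; x∙yz≈y∙xz to +-leftComm)
  open import Algebra.Properties.CommutativeSemigroup *-commutativeSemigroup
    using () renaming (x∙yz≈y∙xz to *-leftComm)

  -- sublistSum S f = Σ_{μ ⊆ S} f μ · ∏_{s ∈ S ∖ μ} x_s
  sublistSum : CellSet → (CellSet → Carrier) → Carrier
  sublistSum []      f = f []
  sublistSum (a ∷ S) f = sublistSum S (f ∘ (a ∷_)) + x a * sublistSum S f

  sublistSum-cong : ∀ S {f g} → (∀ {μ} → μ ⊆ S → f μ ≈ g μ) → sublistSum S f ≈ sublistSum S g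
  sublistSum-cong []      f≈g = f≈g []
  sublistSum-cong (a ∷ S) f≈g =
    +-cong (sublistSum-cong S (f≈g ∘ (refl ∷_))) (*-congˡ (sublistSum-cong S (f≈g ∘ (a ∷ʳ_))))

  sublistSum-0 : ∀ S → sublistSum S (λ _ → 0#) ≈ 0#
  sublistSum-0 []      = ≈-refl
  sublistSum-0 (a ∷ S) = begin
    sublistSum S (λ _ → 0#) + x a * sublistSum S (λ _ → 0#) ≈⟨ +-cong (sublistSum-0 S) (*-congˡ (sublistSum-0 S)) ⟩
    0# + x a * 0#                                           ≈⟨ +-identityˡ _ ⟩
    x a * 0#                                                ≈⟨ zeroʳ _ ⟩
    0#                                                      ∎

  sublistSum-vanish : ∀ S {f} → (∀ {μ} → μ ⊆ S → f μ ≈ 0#) → sublistSum S f ≈ 0#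
  sublistSum-vanish S f≈0 = ≈-trans (sublistSum-cong S f≈0) (sublistSum-0 S)

  sublistSum-+ : ∀ S f g → sublistSum S (λ μ → f μ + g μ) ≈ sublistSum S f + sublistSum S g
  sublistSum-+ []      f g = ≈-refl
  sublistSum-+ (a ∷ S) f g = begin
    sublistSum S (λ μ → f (a ∷ μ) + g (a ∷ μ)) + x a * sublistSum S (λ μ → f μ + g μ)
      ≈⟨ +-cong (sublistSum-+ S _ _) (≈-trans (*-congˡ (sublistSum-+ S f g)) (distribˡ _ _ _)) ⟩
    (sublistSum S (f ∘ (a ∷_)) + sublistSum S (g ∘ (a ∷_))) + (x a * sublistSum S f + x a * sublistSum S g)
      ≈⟨ +-interchange _ _ _ _ ⟩
    (sublistSum S (f ∘ (a ∷_)) + x a * sublistSum S f) + (sublistSum S (g ∘ (a ∷_)) + x a * sublistSum S g)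
      ∎

  sublistSum-*ˡ : ∀ S k f → sublistSum S (λ μ → k * f μ) ≈ k * sublistSum S f
  sublistSum-*ˡ []      k f = ≈-refl
  sublistSum-*ˡ (a ∷ S) k f = begin
    sublistSum S (λ μ → k * f (a ∷ μ)) + x a * sublistSum S (λ μ → k * f μ)
      ≈⟨ +-cong (sublistSum-*ˡ S k _) (≈-trans (*-congˡ (sublistSum-*ˡ S k f)) (*-leftComm _ _ _)) ⟩
    k * sublistSum S (f ∘ (a ∷_)) + k * (x a * sublistSum S f)
      ≈⟨ distribˡ _ _ _ ⟨
    k * (sublistSum S (f ∘ (a ∷_)) + x a * sublistSum S f)
      ∎

  sublistSum-only-[] : ∀ S {f} → (∀ {a μ} → a ∷ μ ⊆ S → f (a ∷ μ) ≈ 0#) →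
                       sublistSum S f ≈ monomial R x S * f []
  sublistSum-only-[] []      f≈0 = ≈-sym (*-identityˡ _)
  sublistSum-only-[] (a ∷ S) {f} f≈0 = begin
    sublistSum S (f ∘ (a ∷_)) + x a * sublistSum S f
      ≈⟨ +-cong (sublistSum-vanish S (f≈0 ∘ (refl ∷_))) (*-congˡ (sublistSum-only-[] S (f≈0 ∘ (a ∷ʳ_)))) ⟩
    0# + x a * (monomial R x S * f [])
      ≈⟨ +-identityˡ _ ⟩
    x a * (monomial R x S * f [])
      ≈⟨ *-assoc _ _ _ ⟨
    monomial R x (a ∷ S) * f []
      ∎

  sublistSum-only-full : ∀ {S} f → Unique S → (∀ {μ c} → μ ⊆ S → c ∈ S → c ∉ μ → f μ ≈ 0#) →
                         sublistSum S f ≈ f S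
  sublistSum-only-full {[]}    f u f≈0 = ≈-refl
  sublistSum-only-full {a ∷ S} f (a∉S ∷ u) f≈0 = begin
    sublistSum S (f ∘ (a ∷_)) + x a * sublistSum S f
      ≈⟨ +-cong (sublistSum-only-full (f ∘ (a ∷_)) u missing-from-S) (*-congˡ (sublistSum-vanish S missing-a)) ⟩
    f (a ∷ S) + x a * 0#
      ≈⟨ +-congˡ (zeroʳ _) ⟩
    f (a ∷ S) + 0#
      ≈⟨ +-identityʳ _ ⟩
    f (a ∷ S)
      ∎
    where
    missing-from-S : ∀ {μ c} → μ ⊆ S → c ∈ S → c ∉ μ → f (a ∷ μ) ≈ 0#
    missing-from-S μ⊆S c∈S c∉μ = f≈0 (refl ∷ μ⊆S) (there c∈S) λ
      { (here refl) → All.lookup a∉S c∈S refl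
      ; (there c∈μ) → c∉μ c∈μ }

    missing-a : ∀ {μ} → μ ⊆ S → f μ ≈ 0#
    missing-a μ⊆S = f≈0 (a ∷ʳ μ⊆S) (here refl) (λ a∈μ → All.lookup a∉S (lookup μ⊆S a∈μ) refl)

  PermInvariant : (CellSet → Carrier) → Set ℓ
  PermInvariant f = ∀ {μ ν} → μ ↭ ν → f μ ≈ f ν

  sublistSum-partition : ∀ (p : Cell → Bool) S {f} → PermInvariant f →
    sublistSum S f ≈ sublistSum (filterᵇ p S) (λ μ → sublistSum (filterᵇ (not ∘ p) S) (λ ν → f (μ ++ ν)))
  sublistSum-partition p []      inv = ≈-refl
  sublistSum-partition p (a ∷ S) {f} inv with p a
  ... | true  = +-cong (sublistSum-partition p S (inv ∘ prep a)) (*-congˡ (sublistSum-partition p S inv))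
  ... | false = begin
    sublistSum S (f ∘ (a ∷_)) + x a * sublistSum S f
      ≈⟨ +-cong (sublistSum-partition p S (inv ∘ prep a)) (*-congˡ (sublistSum-partition p S inv)) ⟩
    sublistSum A (λ μ → sublistSum B (λ ν → f (a ∷ μ ++ ν)))
      + x a * sublistSum A (λ μ → sublistSum B (λ ν → f (μ ++ ν)))
      ≈⟨ +-congˡ (sublistSum-*ˡ A (x a) _) ⟨
    sublistSum A (λ μ → sublistSum B (λ ν → f (a ∷ μ ++ ν)))
      + sublistSum A (λ μ → x a * sublistSum B (λ ν → f (μ ++ ν)))
      ≈⟨ sublistSum-+ A _ _ ⟨
    sublistSum A (λ μ → sublistSum B (λ ν → f (a ∷ μ ++ ν)) + x a * sublistSum B (λ ν → f (μ ++ ν)))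
      ≈⟨ sublistSum-cong A (λ {μ} _ → +-congʳ (sublistSum-cong B (λ {ν} _ → inv (↭-sym (shift a μ ν))))) ⟩
    sublistSum A (λ μ → sublistSum (a ∷ B) (λ ν → f (μ ++ ν)))
      ∎
    where
    A B : CellSet
    A = filterᵇ p S
    B = filterᵇ (not ∘ p) S

  𝟙 : Bool → Carrier
  𝟙 true  = 1#
  𝟙 false = 0#

  sumR-filterᵇ : ∀ {A : Set} (q : A → Bool) (w : A → Carrier) zs →
                 sumR R (map w (filterᵇ q zs)) ≈ sumR R (map (λ z → 𝟙 (q z) * w z) zs)
  sumR-filterᵇ q w []       = ≈-refl
  sumR-filterᵇ q w (z ∷ zs) with q z
  ... | true  = +-cong (≈-sym (*-identityˡ _)) (sumR-filterᵇ q w zs)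
  ... | false = ≈-trans (≈-sym (+-identityˡ _)) (+-cong (≈-sym (zeroˡ _)) (sumR-filterᵇ q w zs))

  splitSum : (CellSet → Carrier) → List (CellSet × CellSet) → Carrier
  splitSum g zs = sumR R (map (λ (μ , ν) → g μ * monomial R x ν) zs)

  splitSum-extend : ∀ a g zs →
    splitSum g (concatMap (λ (μ , ν) → (a ∷ μ , ν) ∷ (μ , a ∷ ν) ∷ []) zs)
      ≈ splitSum (g ∘ (a ∷_)) zs + x a * splitSum g zs
  splitSum-extend a g []             = ≈-sym (≈-trans (+-identityˡ _) (zeroʳ _))
  splitSum-extend a g ((μ , ν) ∷ zs) = begin
    g (a ∷ μ) * m + (g μ * (x a * m) + rest)
      ≈⟨ +-congˡ (+-cong (*-leftComm _ _ _) (splitSum-extend a g zs)) ⟩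
    g (a ∷ μ) * m + (x a * (g μ * m) + (splitSum (g ∘ (a ∷_)) zs + x a * splitSum g zs))
      ≈⟨ +-congˡ (+-leftComm _ _ _) ⟩
    g (a ∷ μ) * m + (splitSum (g ∘ (a ∷_)) zs + (x a * (g μ * m) + x a * splitSum g zs))
      ≈⟨ +-assoc _ _ _ ⟨
    (g (a ∷ μ) * m + splitSum (g ∘ (a ∷_)) zs) + (x a * (g μ * m) + x a * splitSum g zs)
      ≈⟨ +-congˡ (distribˡ _ _ _) ⟨
    (g (a ∷ μ) * m + splitSum (g ∘ (a ∷_)) zs) + x a * (g μ * m + splitSum g zs)
      ∎
    where
    m rest : Carrier
    m = monomial R x ν
    rest = splitSum g (concatMap (λ (μ , ν) → (a ∷ μ , ν) ∷ (μ , a ∷ ν) ∷ []) zs)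

  splitSum-splits : ∀ S g → splitSum g (splits S) ≈ sublistSum S g
  splitSum-splits []      g = ≈-trans (+-identityʳ _) (*-identityʳ _)
  splitSum-splits (a ∷ S) g = ≈-trans (splitSum-extend a g (splits S))
    (+-cong (splitSum-splits S (g ∘ (a ∷_))) (*-congˡ (splitSum-splits S g)))

  F-[] : F R x [] ≈ 1#
  F-[] = +-identityʳ 1#

  χ : CellSet → CellSet → Carrier
  χ S μ = 𝟙 (isInitialᵇ μ S)

  F≈sublistSum : ∀ S → F R x S ≈ sublistSum S (χ S)
  F≈sublistSum S = ≈-trans (sumR-filterᵇ (λ (μ , _) → isInitialᵇ μ S) (monomial R x ∘ proj₂) (splits S))
                           (splitSum-splits S (χ S))

  𝟙-resp-⇔ : ∀ {a b} → T a ⇔ T b → 𝟙 a ≈ 𝟙 b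
  𝟙-resp-⇔ {false} {false} _   = ≈-refl
  𝟙-resp-⇔ {true}  {true}  _   = ≈-refl
  𝟙-resp-⇔ {true}  {false} a⇔b = ⊥-elim (Equivalence.to a⇔b tt)
  𝟙-resp-⇔ {false} {true}  a⇔b = ⊥-elim (Equivalence.from a⇔b tt)

  𝟙-false : ∀ a → ¬ T a → 𝟙 a ≈ 0#
  𝟙-false a ¬a = 𝟙-resp-⇔ {b = false} (mk⇔ ¬a λ ())

  𝟙-∧ : ∀ a b → 𝟙 (a ∧ b) ≈ 𝟙 a * 𝟙 b
  𝟙-∧ false b = ≈-sym (zeroˡ _)
  𝟙-∧ true  b = ≈-sym (*-identityˡ _)

  𝟙-split : ∀ a b → 𝟙 a ≈ 𝟙 (a ∧ not b) + 𝟙 (a ∧ b)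
  𝟙-split false b     = ≈-sym (+-identityˡ _)
  𝟙-split true  false = ≈-sym (+-identityʳ _)
  𝟙-split true  true  = ≈-sym (+-identityˡ _)

  𝟙-resp-↭ : ∀ {P : CellSet → Set} (b : CellSet → Bool) → (∀ μ → T (b μ) ⇔ P μ) →
              (∀ {μ ν} → μ ↭ ν → P μ → P ν) → PermInvariant (𝟙 ∘ b)
  𝟙-resp-↭ b b⇔P P-resp {μ} {ν} μ↭ν = 𝟙-resp-⇔ (mk⇔
    (Equivalence.from (b⇔P ν) ∘ P-resp μ↭ν ∘ Equivalence.to (b⇔P μ))
    (Equivalence.from (b⇔P μ) ∘ P-resp (↭-sym μ↭ν) ∘ Equivalence.to (b⇔P ν)))

  χ-resp-↭ : ∀ S → PermInvariant (χ S)
  χ-resp-↭ S = 𝟙-resp-↭ (λ μ → isInitialᵇ μ S) (λ μ → T-isInitialᵇ μ S) IsInitial-resp-↭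

  F-product : ∀ (p : Cell → Bool) S →
    IsInitial (filterᵇ p S) S → IsInitial (filterᵇ (not ∘ p) S) S →
    F R x S ≈ F R x (filterᵇ p S) * F R x (filterᵇ (not ∘ p) S)
  F-product p S hA hB = begin
    F R x S
      ≈⟨ F≈sublistSum S ⟩
    sublistSum S (χ S)
      ≈⟨ sublistSum-partition p S (χ-resp-↭ S) ⟩
    sublistSum A (λ μ → sublistSum B (λ ν → χ S (μ ++ ν)))
      ≈⟨ sublistSum-cong A (λ μ⊆A → sublistSum-cong B (λ ν⊆B → χ-++ μ⊆A ν⊆B)) ⟩
    sublistSum A (λ μ → sublistSum B (λ ν → χ A μ * χ B ν))
      ≈⟨ sublistSum-cong A (λ {μ} _ → sublistSum-*ˡ B (χ A μ) (χ B)) ⟩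
    sublistSum A (λ μ → χ A μ * sublistSum B (χ B))
      ≈⟨ sublistSum-cong A (λ _ → *-comm _ _) ⟩
    sublistSum A (λ μ → sublistSum B (χ B) * χ A μ)
      ≈⟨ sublistSum-*ˡ A _ (χ A) ⟩
    sublistSum B (χ B) * sublistSum A (χ A)
      ≈⟨ *-comm _ _ ⟩
    sublistSum A (χ A) * sublistSum B (χ B)
      ≈⟨ *-cong (F≈sublistSum A) (F≈sublistSum B) ⟨
    F R x A * F R x B
      ∎
    where
    open Partition p S using (A; B; IsInitial-++)
    χ-++ : ∀ {μ ν} → μ ⊆ A → ν ⊆ B → χ S (μ ++ ν) ≈ χ A μ * χ B ν
    χ-++ {μ} {ν} μ⊆A ν⊆B = ≈-trans
      (𝟙-resp-⇔ (⇔.trans (T-isInitialᵇ (μ ++ ν) S) (⇔.trans (IsInitial-++ hA hB μ⊆A ν⊆B)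
        (⇔.sym (⇔.trans T-∧ (T-isInitialᵇ μ A ×-⇔ T-isInitialᵇ ν B))))))
      (𝟙-∧ (isInitialᵇ μ A) (isInitialᵇ ν B))

  module Corner (S : CellSet) (c : Cell) (c∈S : c ∈ S) where
    module Up = Partition (c ≤ᶜᵇ_) S
    module Down = Partition (_≤ᶜᵇ c) S

    initial∌ᵇ initial∋ᵇ : CellSet → Bool
    initial∌ᵇ μ = isInitialᵇ μ S ∧ not (memᵇ c μ)
    initial∋ᵇ μ = isInitialᵇ μ S ∧ memᵇ c μ

    T-initial∌ᵇ : ∀ μ → T (initial∌ᵇ μ) ⇔ (IsInitial μ S × c ∉ μ)
    T-initial∌ᵇ μ = ⇔.trans T-∧ (T-isInitialᵇ μ S ×-⇔ ⇔.trans T-not (mk⇔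
      (λ ¬c∈ c∈ → ¬c∈ (Equivalence.from (T-memᵇ c μ) c∈))
      (λ c∉ c∈ → c∉ (Equivalence.to (T-memᵇ c μ) c∈))))

    T-initial∋ᵇ : ∀ μ → T (initial∋ᵇ μ) ⇔ (IsInitial μ S × c ∈ μ)
    T-initial∋ᵇ μ = ⇔.trans T-∧ (T-isInitialᵇ μ S ×-⇔ T-memᵇ c μ)

    c∈Up : c ∈ Up.A
    c∈Up = ∈-filterᵇ⁺ (c ≤ᶜᵇ_) c∈S (Equivalence.from (T-≤ᶜᵇ c c) ≤ᶜ-refl)

    c∈Down : c ∈ Down.A
    c∈Down = ∈-filterᵇ⁺ (_≤ᶜᵇ c) c∈S (Equivalence.from (T-≤ᶜᵇ c c) ≤ᶜ-refl)

    avoiding-c-vanishes : ∀ {a μ ν} → a ∷ μ ⊆ Up.A → 𝟙 (initial∌ᵇ (a ∷ μ ++ ν)) ≈ 0#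
    avoiding-c-vanishes {a} {μ} {ν} aμ⊆A = 𝟙-false (initial∌ᵇ (a ∷ μ ++ ν)) λ h →
      let init , c∉ = Equivalence.to (T-initial∌ᵇ (a ∷ μ ++ ν)) h
      in c∉ (init (here refl) c∈S (Equivalence.to (T-≤ᶜᵇ c a) (proj₂ (∈-filterᵇ⁻ _ S (lookup aμ⊆A (here refl))))))

    avoiding-c⇔initial : ∀ {ν} → ν ⊆ Up.B → (IsInitial ν S × c ∉ ν) ⇔ IsInitial ν Up.B
    avoiding-c⇔initial {ν} ν⊆B = mk⇔ to from
      where
      to : IsInitial ν S × c ∉ ν → IsInitial ν Up.B
      to (h , _) = IsInitial-restrict Up.B⊆S h

      from : IsInitial ν Up.B → IsInitial ν S × c ∉ ν
      from h = IsInitial-trans ν⊆B (notAbove-isInitial c S) h , λ c∈ν → Up.A∩B≡∅ c∈Up (lookup ν⊆B c∈ν)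

    containing-c-vanishes : ∀ {μ ν d} → μ ⊆ Down.A → d ∈ Down.A → d ∉ μ → ν ⊆ Down.B →
                            𝟙 (initial∋ᵇ (μ ++ ν)) ≈ 0#
    containing-c-vanishes {μ} {ν} {d} μ⊆A d∈A d∉μ ν⊆B = 𝟙-false (initial∋ᵇ (μ ++ ν)) λ h →
      let init , c∈μν = Equivalence.to (T-initial∋ᵇ (μ ++ ν)) h
          d≤c = Equivalence.to (T-≤ᶜᵇ d c) (proj₂ (∈-filterᵇ⁻ _ S d∈A))
      in [ d∉μ , Down.A∩B≡∅ d∈A ∘ lookup ν⊆B ]′ (∈-++⁻ μ (init c∈μν (Down.A⊆S d∈A) d≤c))

    containing-c⇔initial : ∀ {ν} → ν ⊆ Down.B →
                           (IsInitial (Down.A ++ ν) S × c ∈ Down.A ++ ν) ⇔ IsInitial ν Down.B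
    containing-c⇔initial ν⊆B = ⇔.trans (mk⇔ proj₁ (λ h → h , ∈-++⁺ˡ c∈Down))
                                       (Down.IsInitial-A++ (below-isInitial c S) ν⊆B)

    sublistSum-avoiding-c : sublistSum S (𝟙 ∘ initial∌ᵇ) ≈ monomial R x Up.A * F R x Up.B
    sublistSum-avoiding-c = begin
      sublistSum S (𝟙 ∘ initial∌ᵇ)
        ≈⟨ sublistSum-partition (c ≤ᶜᵇ_) S (𝟙-resp-↭ _ T-initial∌ᵇ λ μ↭ν (h , c∉μ) →
             IsInitial-resp-↭ μ↭ν h , c∉μ ∘ ∈-resp-↭ (↭-sym μ↭ν)) ⟩
      sublistSum Up.A (λ μ → sublistSum Up.B (λ ν → 𝟙 (initial∌ᵇ (μ ++ ν))))
        ≈⟨ sublistSum-only-[] Up.A (λ aμ⊆A → sublistSum-vanish Up.B λ _ → avoiding-c-vanishes aμ⊆A) ⟩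
      monomial R x Up.A * sublistSum Up.B (𝟙 ∘ initial∌ᵇ)
        ≈⟨ *-congˡ (sublistSum-cong Up.B λ {ν} ν⊆B → 𝟙-resp-⇔ (⇔.trans (T-initial∌ᵇ ν)
             (⇔.trans (avoiding-c⇔initial ν⊆B) (⇔.sym (T-isInitialᵇ ν Up.B))))) ⟩
      monomial R x Up.A * sublistSum Up.B (χ Up.B)
        ≈⟨ *-congˡ (F≈sublistSum Up.B) ⟨
      monomial R x Up.A * F R x Up.B
        ∎

    sublistSum-containing-c : Unique S → sublistSum S (𝟙 ∘ initial∋ᵇ) ≈ F R x Down.B
    sublistSum-containing-c uniq = begin
      sublistSum S (𝟙 ∘ initial∋ᵇ)
        ≈⟨ sublistSum-partition (_≤ᶜᵇ c) S (𝟙-resp-↭ _ T-initial∋ᵇ λ μ↭ν (h , c∈μ) →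
             IsInitial-resp-↭ μ↭ν h , ∈-resp-↭ μ↭ν c∈μ) ⟩
      sublistSum Down.A (λ μ → sublistSum Down.B (λ ν → 𝟙 (initial∋ᵇ (μ ++ ν))))
        ≈⟨ sublistSum-only-full _ (filter⁺ (T? ∘ (_≤ᶜᵇ c)) uniq) (λ μ⊆A d∈A d∉μ →
             sublistSum-vanish Down.B (containing-c-vanishes μ⊆A d∈A d∉μ)) ⟩
      sublistSum Down.B (λ ν → 𝟙 (initial∋ᵇ (Down.A ++ ν)))
        ≈⟨ sublistSum-cong Down.B (λ {ν} ν⊆B → 𝟙-resp-⇔ (⇔.trans (T-initial∋ᵇ _)
             (⇔.trans (containing-c⇔initial ν⊆B) (⇔.sym (T-isInitialᵇ ν Down.B))))) ⟩
      sublistSum Down.B (χ Down.B)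
        ≈⟨ F≈sublistSum Down.B ⟨
      F R x Down.B
        ∎

  F-corner : ∀ S c → Unique S → c ∈ S →
    F R x S ≈ monomial R x (filterᵇ (c ≤ᶜᵇ_) S) * F R x (filterᵇ (not ∘ (c ≤ᶜᵇ_)) S)
              + F R x (filterᵇ (not ∘ (_≤ᶜᵇ c)) S)
  F-corner S c uniq c∈S = begin
    F R x S
      ≈⟨ F≈sublistSum S ⟩
    sublistSum S (χ S)
      ≈⟨ sublistSum-cong S (λ {μ} _ → 𝟙-split (isInitialᵇ μ S) (memᵇ c μ)) ⟩
    sublistSum S (λ μ → 𝟙 (initial∌ᵇ μ) + 𝟙 (initial∋ᵇ μ))
      ≈⟨ sublistSum-+ S _ _ ⟩
    sublistSum S (𝟙 ∘ initial∌ᵇ) + sublistSum S (𝟙 ∘ initial∋ᵇ)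
      ≈⟨ +-cong sublistSum-avoiding-c (sublistSum-containing-c uniq) ⟩
    monomial R x Up.A * F R x Up.B + F R x Down.B
      ∎
    where open Corner S c c∈S

module RangeSum {r ℓ : Level} (R : CommutativeRing r ℓ) where
  open CommutativeRing R renaming (refl to ≈-refl; trans to ≈-trans)

  sumFrom : ℕ → ℕ → (ℕ → Carrier) → Carrier
  sumFrom a zero    f = 0#
  sumFrom a (suc n) f = f a + sumFrom (suc a) n f

  sumFin≈sumFrom : ∀ n a (g : Fin n → Carrier) f → (∀ k → g k ≈ f (a +ℕ toℕ k)) →
                   sumFin R n g ≈ sumFrom a n f
  sumFin≈sumFrom zero    a g f g≈f = ≈-refl
  sumFin≈sumFrom (suc n) a g f g≈f = +-cong
    (≈-trans (g≈f Fin.zero) (reflexive (≡.cong f (ℕ.+-identityʳ a))))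
    (sumFin≈sumFrom n (suc a) (g ∘ Fin.suc) f λ k →
      ≈-trans (g≈f (Fin.suc k)) (reflexive (≡.cong f (ℕ.+-suc a (toℕ k)))))

T-Usetᵇ : ∀ i k c → T ((i ≤ᵇ proj₁ c) ∧ (proj₁ c <ᵇ k) ∧ (k ≤ᵇ proj₂ c)) ⇔
                    (i ≤ proj₁ c × proj₁ c < k × k ≤ proj₂ c)
T-Usetᵇ i k c = ⇔.trans T-∧ (T-≤ᵇ _ _ ×-⇔ ⇔.trans T-∧ (T-<ᵇ _ _ ×-⇔ T-≤ᵇ _ _))

T-Lsetᵇ : ∀ j k c → T ((j ≤ᵇ proj₂ c) ∧ (proj₂ c <ᵇ k) ∧ (k ≤ᵇ proj₁ c)) ⇔
                    (j ≤ proj₂ c × proj₂ c < k × k ≤ proj₁ c)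
T-Lsetᵇ j k c = ⇔.trans T-∧ (T-≤ᵇ _ _ ×-⇔ ⇔.trans T-∧ (T-<ᵇ _ _ ×-⇔ T-≤ᵇ _ _))

Uset-diagonal : ∀ L k → Uset L k k ≡ []
Uset-diagonal L k = filter-none _ {L} (All.tabulate λ {c} _ t →
  let k≤u , u<k , _ = Equivalence.to (T-Usetᵇ k k c) t in <⇒≱ u<k k≤u)

Lset-diagonal : ∀ L k → Lset L k k ≡ []
Lset-diagonal L k = filter-none _ {L} (All.tabulate λ {c} _ t →
  let k≤v , v<k , _ = Equivalence.to (T-Lsetᵇ k k c) t in <⇒≱ v<k k≤v)

module Peeling {r ℓ : Level} (R : CommutativeRing r ℓ) (x : Cell → CommutativeRing.Carrier R)
  (L : CellSet) (d : ℕ) (uniq : Unique L)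
  (diagonal : ∀ {k} → 1 ≤ k → k ≤ d → (k , k) ∈ L)
  (bounded : ∀ {c} → c ∈ L → ¬ ((suc d , suc d) ≤ᶜ c))
  (i j : ℕ) where

  open CommutativeRing R renaming (refl to ≈-refl; sym to ≈-sym; trans to ≈-trans)
  open Expansion R x
  open RangeSum R
  open import Relation.Binary.Reasoning.Setoid setoid

  outside : ℕ → Cell → Bool
  outside m c = not (c ≤ᶜᵇ (m , m))

  T-outside : ∀ m c → T (outside m c) ⇔ (m < proj₁ c ⊎ m < proj₂ c)
  T-outside m c = ⇔.trans T-not (mk⇔ to from)
    where
    to : ¬ T (c ≤ᶜᵇ (m , m)) → m < proj₁ c ⊎ m < proj₂ c
    to c≰m with proj₁ c ≤? m | proj₂ c ≤? m
    ... | yes u≤m | yes v≤m = ⊥-elim (c≰m (Equivalence.from (T-≤ᶜᵇ c (m , m)) (u≤m , v≤m)))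
    ... | no u≰m  | _       = inj₁ (≰⇒> u≰m)
    ... | yes _   | no v≰m  = inj₂ (≰⇒> v≰m)

    from : m < proj₁ c ⊎ m < proj₂ c → ¬ T (c ≤ᶜᵇ (m , m))
    from m<u⊎v c≤m with Equivalence.to (T-≤ᶜᵇ c (m , m)) c≤m | m<u⊎v
    ... | u≤m , _ | inj₁ m<u = <⇒≱ m<u u≤m
    ... | _ , v≤m | inj₂ m<v = <⇒≱ m<v v≤m

  outside-suc : ∀ {m c} → suc m < proj₁ c ⊎ suc m < proj₂ c → m < proj₁ c ⊎ m < proj₂ c
  outside-suc (inj₁ m<u) = inj₁ (<⇒≤ m<u)
  outside-suc (inj₂ m<v) = inj₂ (<⇒≤ m<v)

  sqᵇ : ℕ → Cell → Bool
  sqᵇ m c = ((i , j) ≤ᶜᵇ c) ∧ outside m c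

  Sq : ℕ → CellSet
  Sq m = filterᵇ (sqᵇ m) L

  T-sqᵇ : ∀ m c → T (sqᵇ m c) ⇔ ((i , j) ≤ᶜ c × (m < proj₁ c ⊎ m < proj₂ c))
  T-sqᵇ m c = ⇔.trans T-∧ (T-≤ᶜᵇ (i , j) c ×-⇔ T-outside m c)

  hookᵇ : ℕ → Cell → Bool
  hookᵇ m c = sqᵇ m c ∧ not ((suc m , suc m) ≤ᶜᵇ c)

  Hook : ℕ → CellSet
  Hook m = filterᵇ (hookᵇ m) L

  HookShape : ℕ → Cell → Set
  HookShape m (u , v) = (u ≤ m × m < v) ⊎ (m < u × v ≤ m)

  T-hookᵇ : ∀ m c → T (hookᵇ m c) ⇔ ((i , j) ≤ᶜ c × HookShape m c)
  T-hookᵇ m c@(u , v) = ⇔.trans T-∧ (⇔.trans (T-sqᵇ m c ×-⇔ T-not) (mk⇔ to from))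
    where
    above : T ((suc m , suc m) ≤ᶜᵇ c) → (suc m , suc m) ≤ᶜ c
    above = Equivalence.to (T-≤ᶜᵇ (suc m , suc m) c)

    to : ((i , j) ≤ᶜ c × (m < u ⊎ m < v)) × ¬ T ((suc m , suc m) ≤ᶜᵇ c) → (i , j) ≤ᶜ c × HookShape m c
    to ((ij≤c , out) , ¬above) with u ≤? m | v ≤? m | out
    ... | yes u≤m | _       | inj₁ m<u = ⊥-elim (<⇒≱ m<u u≤m)
    ... | yes u≤m | _       | inj₂ m<v = ij≤c , inj₁ (u≤m , m<v)
    ... | no u≰m  | yes v≤m | _        = ij≤c , inj₂ (≰⇒> u≰m , v≤m)
    ... | no u≰m  | no v≰m  | _        =
      ⊥-elim (¬above (Equivalence.from (T-≤ᶜᵇ (suc m , suc m) c) (≰⇒> u≰m , ≰⇒> v≰m)))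

    from : (i , j) ≤ᶜ c × HookShape m c → ((i , j) ≤ᶜ c × (m < u ⊎ m < v)) × ¬ T ((suc m , suc m) ≤ᶜᵇ c)
    from (ij≤c , inj₁ (u≤m , m<v)) = (ij≤c , inj₂ m<v) , λ t → <⇒≱ (proj₁ (above t)) u≤m
    from (ij≤c , inj₂ (m<u , v≤m)) = (ij≤c , inj₁ m<u) , λ t → <⇒≱ (proj₂ (above t)) v≤m

  ∈-Hook⇒HookShape : ∀ {m c} → c ∈ Hook m → HookShape m c
  ∈-Hook⇒HookShape {m} {c} c∈H = proj₂ (Equivalence.to (T-hookᵇ m c) (proj₂ (∈-filterᵇ⁻ (hookᵇ m) L c∈H)))

  upperArm : ℕ → Cell → Bool
  upperArm m c = proj₁ c ≤ᵇ m

  Hook-upper : ∀ {m} → j ≤ suc m → filterᵇ (upperArm m) (Hook m) ≡ Uset L i (suc m)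
  Hook-upper {m} j≤k = filterᵇ-filterᵇ-≐ (hookᵇ m) (upperArm m) _ L λ {c} _ →
    ⇔.trans T-∧ (⇔.trans (T-hookᵇ m c ×-⇔ T-≤ᵇ _ _) (⇔.trans (mk⇔ to from) (⇔.sym (T-Usetᵇ i (suc m) c))))
    where
    to : ∀ {c} → ((i , j) ≤ᶜ c × HookShape m c) × proj₁ c ≤ m →
         i ≤ proj₁ c × proj₁ c < suc m × suc m ≤ proj₂ c
    to ((ij≤c , inj₁ (_ , m<v)) , u≤m) = proj₁ ij≤c , s≤s u≤m , m<v
    to ((_ , inj₂ (m<u , _)) , u≤m)    = ⊥-elim (<⇒≱ m<u u≤m)

    from : ∀ {c} → i ≤ proj₁ c × proj₁ c < suc m × suc m ≤ proj₂ c →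
           ((i , j) ≤ᶜ c × HookShape m c) × proj₁ c ≤ m
    from (i≤u , s≤s u≤m , k≤v) = ((i≤u , ≤-trans j≤k k≤v) , inj₁ (u≤m , k≤v)) , u≤m

  Hook-lower : ∀ {m} → i ≤ suc m → filterᵇ (not ∘ upperArm m) (Hook m) ≡ Lset L (suc m) j
  Hook-lower {m} i≤k = filterᵇ-filterᵇ-≐ (hookᵇ m) (not ∘ upperArm m) _ L λ {c} _ →
    ⇔.trans T-∧ (⇔.trans (T-hookᵇ m c ×-⇔ ⇔.trans T-not (mk⇔ (_∘ ≤⇒≤ᵇ) (_∘ ≤ᵇ⇒≤ _ _)))
                         (⇔.trans (mk⇔ to from) (⇔.sym (T-Lsetᵇ j (suc m) c))))
    where
    to : ∀ {c} → ((i , j) ≤ᶜ c × HookShape m c) × ¬ (proj₁ c ≤ m) →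
         j ≤ proj₂ c × proj₂ c < suc m × suc m ≤ proj₁ c
    to ((_ , inj₁ (u≤m , _)) , u≰m)    = ⊥-elim (u≰m u≤m)
    to ((ij≤c , inj₂ (m<u , v≤m)) , _) = proj₂ ij≤c , s≤s v≤m , m<u

    from : ∀ {c} → j ≤ proj₂ c × proj₂ c < suc m × suc m ≤ proj₁ c →
           ((i , j) ≤ᶜ c × HookShape m c) × ¬ (proj₁ c ≤ m)
    from (j≤v , s≤s v≤m , k≤u) = ((≤-trans i≤k k≤u , j≤v) , inj₂ (k≤u , v≤m)) , <⇒≱ k≤u

  F-Hook : ∀ {m} → i ≤ suc m → j ≤ suc m → F R x (Hook m) ≈ F R x (Uset L i (suc m)) * F R x (Lset L (suc m) j)
  F-Hook {m} i≤k j≤k = begin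
    F R x (Hook m)
      ≈⟨ F-product (upperArm m) (Hook m) upper-isInitial lower-isInitial ⟩
    F R x (filterᵇ (upperArm m) (Hook m)) * F R x (filterᵇ (not ∘ upperArm m) (Hook m))
      ≡⟨ cong₂ (λ U V → F R x U * F R x V) (Hook-upper j≤k) (Hook-lower i≤k) ⟩
    F R x (Uset L i (suc m)) * F R x (Lset L (suc m) j)
      ∎
    where
    open Partition (upperArm m) (Hook m) using (A; B)

    upper-isInitial : IsInitial A (Hook m)
    upper-isInitial {e} {c'} e∈A c'∈H c'≤e = ∈-filterᵇ⁺ (upperArm m) c'∈H
      (≤⇒≤ᵇ (≤-trans (proj₁ c'≤e) (≤ᵇ⇒≤ _ _ (proj₂ (∈-filterᵇ⁻ (upperArm m) (Hook m) e∈A)))))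

    lower-isInitial : IsInitial B (Hook m)
    lower-isInitial {e} {c'} e∈B c'∈H c'≤e
      with ∈-filterᵇ⁻ (not ∘ upperArm m) (Hook m) e∈B | ∈-Hook⇒HookShape c'∈H
    ... | e∈H , ¬e↑ | inj₂ (m<u' , _) = ∈-filterᵇ⁺ (not ∘ upperArm m) c'∈H
                                          (Equivalence.from T-not (<⇒≱ m<u' ∘ ≤ᵇ⇒≤ _ _))
    ... | e∈H , ¬e↑ | inj₁ (_ , m<v') with ∈-Hook⇒HookShape e∈H
    ...   | inj₁ (u≤m , _) = ⊥-elim (Equivalence.to T-not ¬e↑ (≤⇒≤ᵇ u≤m))
    ...   | inj₂ (_ , v≤m) = ⊥-elim (<⇒≱ m<v' (≤-trans (proj₂ c'≤e) v≤m))

  Sq-0 : 1 ≤ i → Sq 0 ≡ subλ L i j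
  Sq-0 1≤i = filterᵇ-cong L λ {c} _ → mk⇔ (proj₁ ∘ Equivalence.to (T-∧ {(i , j) ≤ᶜᵇ c})) λ ij≤c →
    Equivalence.from (T-sqᵇ 0 c) (Equivalence.to (T-≤ᶜᵇ (i , j) c) ij≤c ,
      inj₁ (≤-trans 1≤i (proj₁ (Equivalence.to (T-≤ᶜᵇ (i , j) c) ij≤c))))

  Sq-skip : ∀ {m} → suc m < i ⊎ suc m < j → Sq m ≡ Sq (suc m)
  Sq-skip {m} k<i⊎k<j = filterᵇ-cong L λ {c} _ → ⇔.trans (T-sqᵇ m c) (⇔.trans
    (mk⇔ (λ (ij≤c , _) → ij≤c , beyond ij≤c k<i⊎k<j) (λ (ij≤c , out) → ij≤c , outside-suc out))
    (⇔.sym (T-sqᵇ (suc m) c)))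
    where
    beyond : ∀ {c} → (i , j) ≤ᶜ c → suc m < i ⊎ suc m < j → suc m < proj₁ c ⊎ suc m < proj₂ c
    beyond (i≤u , _) (inj₁ k<i) = inj₁ (<-≤-trans k<i i≤u)
    beyond (_ , j≤v) (inj₂ k<j) = inj₂ (<-≤-trans k<j j≤v)

  Sq-corner-above : ∀ {m} → i ≤ suc m → j ≤ suc m →
                    filterᵇ ((suc m , suc m) ≤ᶜᵇ_) (Sq m) ≡ subλ L (suc m) (suc m)
  Sq-corner-above {m} i≤k j≤k = filterᵇ-filterᵇ-≐ (sqᵇ m) ((suc m , suc m) ≤ᶜᵇ_) _ L λ {c} _ →
    mk⇔ (proj₂ ∘ Equivalence.to (T-∧ {sqᵇ m c})) λ above →
      Equivalence.from (T-∧ {sqᵇ m c}) (inSq (Equivalence.to (T-≤ᶜᵇ _ c) above) , above)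
    where
    inSq : ∀ {c} → (suc m , suc m) ≤ᶜ c → T (sqᵇ m c)
    inSq {c} (k≤u , k≤v) = Equivalence.from (T-sqᵇ m c) ((≤-trans i≤k k≤u , ≤-trans j≤k k≤v) , inj₁ k≤u)

  Sq-corner-below : ∀ m → filterᵇ (outside (suc m)) (Sq m) ≡ Sq (suc m)
  Sq-corner-below m = filterᵇ-filterᵇ-≐ (sqᵇ m) (outside (suc m)) (sqᵇ (suc m)) L λ {c} _ →
    ⇔.trans T-∧ (⇔.trans (T-sqᵇ m c ×-⇔ T-outside (suc m) c) (⇔.trans
      (mk⇔ (λ ((ij≤c , _) , out) → ij≤c , out) (λ (ij≤c , out) → (ij≤c , outside-suc out) , out))
      (⇔.sym (T-sqᵇ (suc m) c))))

  Sq-last : Sq d ≡ Hook d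
  Sq-last = filterᵇ-cong L λ {c} c∈L → mk⇔
    (λ t → Equivalence.from (T-∧ {sqᵇ d c}) (t , Equivalence.from T-not λ above →
             bounded c∈L (Equivalence.to (T-≤ᶜᵇ _ c) above)))
    (proj₁ ∘ Equivalence.to (T-∧ {sqᵇ d c}))

  upperEntry lowerEntry diagonalEntry term : ℕ → Carrier
  upperEntry    k = if i ≤ᵇ k then F R x (Uset L i k) else 0#
  lowerEntry    k = if j ≤ᵇ k then F R x (Lset L k j) else 0#
  diagonalEntry k = monomial R x (subλ L k k)
  term          k = upperEntry k * diagonalEntry k * lowerEntry k

  term-inside : ∀ {k} → i ≤ k → j ≤ k →
                term k ≡ F R x (Uset L i k) * diagonalEntry k * F R x (Lset L k j)
  term-inside {k} i≤k j≤k = cong₂ (λ U V → U * diagonalEntry k * V)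
    (if-T (≤⇒≤ᵇ i≤k)) (if-T (≤⇒≤ᵇ j≤k))

  term-outside : ∀ {k} → k < i ⊎ k < j → term k ≈ 0#
  term-outside {k} (inj₁ k<i) = begin
    upperEntry k * diagonalEntry k * lowerEntry k
      ≡⟨ cong (λ U → U * diagonalEntry k * lowerEntry k) (if-¬T (<⇒≱ k<i ∘ ≤ᵇ⇒≤ _ _)) ⟩
    0# * diagonalEntry k * lowerEntry k
      ≈⟨ *-congʳ (zeroˡ _) ⟩
    0# * lowerEntry k
      ≈⟨ zeroˡ _ ⟩
    0#
      ∎
  term-outside {k} (inj₂ k<j) = begin
    upperEntry k * diagonalEntry k * lowerEntry k
      ≡⟨ cong (upperEntry k * diagonalEntry k *_) (if-¬T (<⇒≱ k<j ∘ ≤ᵇ⇒≤ _ _)) ⟩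
    upperEntry k * diagonalEntry k * 0#
      ≈⟨ zeroʳ _ ⟩
    0#
      ∎

  F-Sq-corner : ∀ {m} → i ≤ suc m → j ≤ suc m → suc m ≤ d →
                F R x (Sq m) ≈ term (suc m) + F R x (Sq (suc m))
  F-Sq-corner {m} i≤k j≤k k≤d = begin
    F R x (Sq m)
      ≈⟨ F-corner (Sq m) (k , k) (filter⁺ (T? ∘ sqᵇ m) uniq) k∈Sq ⟩
    monomial R x (filterᵇ ((k , k) ≤ᶜᵇ_) (Sq m)) * F R x (filterᵇ (not ∘ ((k , k) ≤ᶜᵇ_)) (Sq m))
      + F R x (filterᵇ (outside k) (Sq m))
      ≡⟨ cong₂ (λ D S → monomial R x D * F R x (filterᵇ (not ∘ ((k , k) ≤ᶜᵇ_)) (Sq m)) + F R x S)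
               (Sq-corner-above i≤k j≤k) (Sq-corner-below m) ⟩
    diagonalEntry k * F R x (filterᵇ (not ∘ ((k , k) ≤ᶜᵇ_)) (Sq m)) + F R x (Sq k)
      ≡⟨ cong (λ H → diagonalEntry k * F R x H + F R x (Sq k)) (filterᵇ-filterᵇ (sqᵇ m) _ L) ⟩
    diagonalEntry k * F R x (Hook m) + F R x (Sq k)
      ≈⟨ +-congʳ (*-congˡ (F-Hook i≤k j≤k)) ⟩
    diagonalEntry k * (F R x (Uset L i k) * F R x (Lset L k j)) + F R x (Sq k)
      ≈⟨ +-congʳ (≈-trans (*-congʳ (*-comm _ _)) (*-assoc _ _ _)) ⟨
    F R x (Uset L i k) * diagonalEntry k * F R x (Lset L k j) + F R x (Sq k)
      ≡⟨ cong (_+ F R x (Sq k)) (term-inside i≤k j≤k) ⟨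
    term k + F R x (Sq k)
      ∎
    where
    k : ℕ
    k = suc m

    k∈Sq : (k , k) ∈ Sq m
    k∈Sq = ∈-filterᵇ⁺ (sqᵇ m) (diagonal (s≤s z≤n) k≤d)
             (Equivalence.from (T-sqᵇ m (k , k)) ((i≤k , j≤k) , inj₁ ≤-refl))

  F-Sq-skip : ∀ {m} → suc m < i ⊎ suc m < j → F R x (Sq m) ≈ term (suc m) + F R x (Sq (suc m))
  F-Sq-skip {m} k<i⊎k<j = begin
    F R x (Sq m)               ≡⟨ cong (F R x) (Sq-skip k<i⊎k<j) ⟩
    F R x (Sq (suc m))         ≈⟨ +-identityˡ _ ⟨
    0# + F R x (Sq (suc m))    ≈⟨ +-congʳ (term-outside k<i⊎k<j) ⟨
    term (suc m) + F R x (Sq (suc m)) ∎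

  F-Sq-step : ∀ {m} → suc m ≤ d → F R x (Sq m) ≈ term (suc m) + F R x (Sq (suc m))
  F-Sq-step {m} k≤d with i ≤? suc m | j ≤? suc m
  ... | yes i≤k | yes j≤k = F-Sq-corner i≤k j≤k k≤d
  ... | no i≰k  | _       = F-Sq-skip (inj₁ (≰⇒> i≰k))
  ... | yes _   | no j≰k  = F-Sq-skip (inj₂ (≰⇒> j≰k))

  subλ-beyond : subλ L (suc d) (suc d) ≡ []
  subλ-beyond = filter-none (T? ∘ ((suc d , suc d) ≤ᶜᵇ_))
    (All.tabulate λ {c} c∈L → bounded c∈L ∘ Equivalence.to (T-≤ᶜᵇ _ c))

  F-Sq-last : i ≤ suc d → j ≤ suc d → F R x (Sq d) ≈ term (suc d)
  F-Sq-last i≤k j≤k = begin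
    F R x (Sq d)
      ≡⟨ cong (F R x) Sq-last ⟩
    F R x (Hook d)
      ≈⟨ F-Hook i≤k j≤k ⟩
    F R x (Uset L i (suc d)) * F R x (Lset L (suc d) j)
      ≈⟨ *-congʳ (*-identityʳ _) ⟨
    F R x (Uset L i (suc d)) * 1# * F R x (Lset L (suc d) j)
      ≡⟨ cong (λ D → F R x (Uset L i (suc d)) * monomial R x D * F R x (Lset L (suc d) j)) subλ-beyond ⟨
    F R x (Uset L i (suc d)) * diagonalEntry (suc d) * F R x (Lset L (suc d) j)
      ≡⟨ term-inside i≤k j≤k ⟨
    term (suc d)
      ∎

  F-Sq : i ≤ suc d → j ≤ suc d → ∀ n {m} → m +ℕ n ≡ d → F R x (Sq m) ≈ sumFrom (suc m) (suc n) term
  F-Sq i≤k j≤k zero {m} m+0≡d = ≡.subst (λ m → F R x (Sq m) ≈ sumFrom (suc m) 1 term)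
    (≡.trans (≡.sym m+0≡d) (ℕ.+-identityʳ m)) (≈-trans (F-Sq-last i≤k j≤k) (≈-sym (+-identityʳ _)))
  F-Sq i≤k j≤k (suc n) {m} m+n+1≡d = ≈-trans (F-Sq-step k≤d) (+-congˡ (F-Sq i≤k j≤k n k+n≡d))
    where
    k+n≡d : suc m +ℕ n ≡ d
    k+n≡d = ≡.trans (≡.sym (ℕ.+-suc m n)) m+n+1≡d
    k≤d : suc m ≤ d
    k≤d = ≤-trans (ℕ.m≤m+n (suc m) n) (ℕ.≤-reflexive k+n≡d)

YoungDiagram : CellSet → Set
YoungDiagram λ' = ∀ i j i' j' → (i , j) ∈ λ' → 1 ≤ i' → i' ≤ i → 1 ≤ j' → j' ≤ j → (i' , j') ∈ λ'

diagonal-∈ : ∀ {λ' d} → YoungDiagram λ' → d ≡ 0 ⊎ (d , d) ∈ λ' → ∀ {k} → 1 ≤ k → k ≤ d → (k , k) ∈ λ'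
diagonal-∈ {d = d} young (inj₁ refl)  1≤k k≤d = ⊥-elim (<⇒≱ 1≤k k≤d)
diagonal-∈ {d = d} young (inj₂ dd∈λ) {k} 1≤k k≤d = young d d k k dd∈λ 1≤k k≤d 1≤k k≤d

beyond-diagonal-∉ : ∀ {λ' d} → YoungDiagram λ' → (suc d , suc d) ∉ λ' →
                    ∀ {c} → c ∈ λ' → ¬ ((suc d , suc d) ≤ᶜ c)
beyond-diagonal-∉ {d = d} young d+1∉λ {u , v} c∈λ (d<u , d<v) =
  d+1∉λ (young u v (suc d) (suc d) c∈λ (s≤s z≤n) d<u (s≤s z≤n) d<v)

module MatrixEntries {r ℓ : Level} (R : CommutativeRing r ℓ) (λ' : CellSet)
                     (x : Cell → CommutativeRing.Carrier R) (d : ℕ) where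
  open CommutativeRing R using (_≈_; 0#; 1#; reflexive) renaming (trans to ≈-trans)
  open Matrices R λ' x d
  open Expansion R x using (F-[])

  Umat≡ : ∀ i k → Umat i k ≡ (if ix i ≤ᵇ ix k then F R x (Uset λ' (ix i) (ix k)) else 0#)
  Umat≡ i k with ix i ≤ᵇ ix k
  ... | true  = refl
  ... | false = refl

  Lmat≡ : ∀ k j → Lmat k j ≡ (if ix j ≤ᵇ ix k then F R x (Lset λ' (ix k) (ix j)) else 0#)
  Lmat≡ k j with ix j ≤ᵇ ix k
  ... | true  = refl
  ... | false = refl

  Umat-diagonal : ∀ k → Umat k k ≈ 1#
  Umat-diagonal k = ≈-trans (reflexive (≡.trans (Umat≡ k k)
    (≡.trans (if-T (≤⇒≤ᵇ (≤-refl {ix k}))) (cong (F R x) (Uset-diagonal λ' (ix k)))))) F-[]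

  Lmat-diagonal : ∀ k → Lmat k k ≈ 1#
  Lmat-diagonal k = ≈-trans (reflexive (≡.trans (Lmat≡ k k)
    (≡.trans (if-T (≤⇒≤ᵇ (≤-refl {ix k}))) (cong (F R x) (Lset-diagonal λ' (ix k)))))) F-[]

theorem5p1 : {c ℓ : Level} (R : CommutativeRing c ℓ) (λ' : CellSet) (d : ℕ)
    → Unique λ'
    → All (λ s → 1 ≤ proj₁ s × 1 ≤ proj₂ s) λ'
    → (∀ i j i' j' → (i , j) ∈ λ' → 1 ≤ i' → i' ≤ i → 1 ≤ j' → j' ≤ j → (i' , j') ∈ λ')
    → (d ≡ 0 ⊎ (d , d) ∈ λ')
    → ¬ ((suc d , suc d) ∈ λ')
    → (x : Cell → CommutativeRing.Carrier R)
    → let open CommutativeRing R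
          open Matrices R λ' x d
      in ((i j : Fin (suc d)) → Amat i j ≈ UDL i j)
         × ((k : Fin (suc d)) → Umat k k ≈ 1#)
         × ((k : Fin (suc d)) → Lmat k k ≈ 1#)
theorem5p1 R λ' d uniq _ young d-diagonal d+1∉λ x = A≈UDL , Umat-diagonal , Lmat-diagonal
  where
  open CommutativeRing R using (_≈_; _*_; setoid; reflexive)
  open Matrices R λ' x d
  open MatrixEntries R λ' x d
  open RangeSum R
  open import Relation.Binary.Reasoning.Setoid setoid

  A≈UDL : ∀ i j → Amat i j ≈ UDL i j
  A≈UDL i j = begin
    Amat i j                 ≡⟨ cong (F R x) (Sq-0 (s≤s z≤n)) ⟨
    F R x (Sq 0)             ≈⟨ F-Sq (toℕ<n i) (toℕ<n j) d refl ⟩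
    sumFrom 1 (suc d) term   ≈⟨ sumFin≈sumFrom (suc d) 1 _ term (λ k →
                                  reflexive (cong₂ (λ U V → U * Dmat k * V) (Umat≡ i k) (Lmat≡ k j))) ⟨
    UDL i j                  ∎
    where
    open Peeling R x λ' d uniq (diagonal-∈ young d-diagonal) (beyond-diagonal-∉ young d+1∉λ) (ix i) (ix j)
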